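{- Let $k\geq 1$ and $n\geq 0$. Then \[ \mathcal{T}_k(n)=\bigcup_{\lambda\in\mathcal{D}_k(n)}\ \bigcup_{\substack{d\geq 1,\ k\nmid d\\ F_{k,d}\cap\lambda\neq\emptyset}}\mathcal{T}_{\lambda,k,d}, \] and the sets $\mathcal{T}_{\lambda,k,d}$ (for the different pairs $(\lambda,d)$) are pairwise disjoint.
   Context: A partition of $n$ is a finite nonincreasing sequence of positive integers summing to $n$. $\mathcal{D}_k(n)$ is the set of partitions of $n$ in which no part occurs $k$ or more times; $\mathcal{T}_k(n)$ is the set of partitions of $n$ in which exactly one part value occurs more than $k$ times and fewer than $2k$ times while every other part value occurs fewer than $k$ times. For $k\geq 2$, every positive integer $N$ is uniquely $N=k^m d$ with $m\geq0$, $k\nmid d$; for $k\nmid d$ let $F_{k,d}=\{k^md:m\geq 0\}$, and let $F_{k,d}\cap\lambda$ be the set of distinct part values of $\lambda$ lying in $F_{k,d}$. (When $k=1$ there is no $d$ with $1\nmid d$, so the inner union is empty.) For $\lambda\in\mathcal{D}_k(n)$ and such $d$ with $F_{k,d}\cap\lambda=\{k^{a_1}d,\dots,k^{a_p}d\}$, $0\leq a_1<\cdots<a_p$, and for $1\leq i\leq p-1$, let $\tau^i_d$ be the partition obtained from $\lambda$ by replacing one part equal to $k^{a_{i+1}}d$ by $k$ parts equal to $k^{a_i}d$ together with $k-1$ parts equal to $k^{a_i+t}d$ for each $t=1,2,\dots,a_{i+1}-a_i-1$. Define $\mathcal{T}_{\lambda,k,d}=\{\tau^1_d,\dots,\tau^{p-1}_d\}$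 (empty if $p=1$). -}

module Defs where

open import Data.Nat using (ℕ; suc; _+_; _*_; _∸_; _^_; _≤_; _<_; _≥_; _≟_)
open import Data.Nat.Divisibility using (_∣_)
open import Data.List using (List; []; _∷_; _++_; filter; length; replicate; concatMap; upTo)
open import Data.Nat.ListAction using (sum)
open import Data.List.Relation.Unary.All using (All)
open import Data.List.Relation.Unary.Linked using (Linked)
open import Data.List.Membership.Propositional using (_∈_; _∉_)
open import Data.List.Relation.Binary.Permutation.Propositional using (_↭_)
open import Data.Product using (Σ; ∃; ∃-syntax; _×_)
open import Relation.Binary.PropositionalEquality using (_≡_; _≢_)

IsPartition : ℕ → List ℕ → Set
IsPartition n λs = Linked _≥_ λs × All (λ x → 0 < x) λs × sum λs ≡ n

mult : ℕ → List ℕ → ℕ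
mult v λs = length (filter (v ≟_) λs)

D : ℕ → ℕ → List ℕ → Set
D k n λs = IsPartition n λs × All (λ v → mult v λs < k) λs

T : ℕ → ℕ → List ℕ → Set
T k n λs = IsPartition n λs ×
  ∃[ v ] (k < mult v λs × mult v λs < 2 * k ×
          (∀ w → w ∈ λs → w ≢ v → mult w λs < k))

FMeets : ℕ → ℕ → List ℕ → Set
FMeets k d λs = ∃[ m ] (k ^ m * d ∈ λs)

-- a < b are consecutive elements of {a_1 < ... < a_p}, i.e. (a,b) = (a_i, a_{i+1})
Consecutive : ℕ → ℕ → List ℕ → ℕ → ℕ → Set
Consecutive k d λs a b =
  a < b × k ^ a * d ∈ λs × k ^ b * d ∈ λs ×
  (∀ c → a < c → c < b → k ^ c * d ∉ λs)

-- the parts inserted by τ: k copies of k^a d, and k-1 copies of k^(a+t) d for t = 1..b-a-1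
added : ℕ → ℕ → ℕ → ℕ → List ℕ
added k d a b =
  replicate k (k ^ a * d) ++
  concatMap (λ j → replicate (k ∸ 1) (k ^ (a + suc j) * d)) (upTo (b ∸ a ∸ 1))

-- μ ∈ 𝒯_{λ,k,d}: μ is (the partition) τ^i_d(λ) for some i, where (a_i,a_{i+1}) = (a,b):
-- one part k^b d of λ is replaced by the parts `added k d a b`.
InTau : ℕ → ℕ → List ℕ → List ℕ → Set
InTau k d λs μ =
  Linked _≥_ μ ×
  ∃[ a ] ∃[ b ] (Consecutive k d λs a b ×
    ∃[ rest ] (λs ↭ (k ^ b * d ∷ rest) × μ ↭ (rest ++ added k d a b)))

-- Write the part of μ ∈ 𝒯_k(n) that occurs between k and 2k times as k^a d with k ∤ d, and let
-- b > a be the least exponent for which k^b d does not occur exactly k − 1 times in μ (it exists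
-- because no part of μ exceeds n). Then μ contains the parts that τ adds at (a, b), and exchanging
-- them for one part k^b d gives λ ∈ 𝒟_k(n) with μ = τ(λ). Conversely a τ-move at consecutive
-- exponents a < b raises the multiplicity of k^a d by k, leaves k − 1 copies of each k^c d with
-- a < c < b and removes one copy of k^b d, so every other multiplicity stays below k. These
-- multiplicities recover (a, d), then b, and then λ from μ, which gives disjointness.

module Submission where

open import Defs
open import Data.Nat
open import Data.Nat.Properties
open import Data.Nat.Divisibility using (_∣_; _∣?_; divides; _∣0; 1∣_; m∣m*n; ∣m⇒∣m*n)
open import Data.Nat.Induction using (<-wellFounded)
open import Data.Nat.ListAction using (sum)
open import Data.Nat.ListAction.Properties using (sum-++; sum-↭)
open import Data.List using (List; []; _∷_; _++_; [_]; filter; length; replicate; concatMap; applyUpTo)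
open import Data.List.Properties using (length-++; length-replicate; filter-++; filter-all; filter-none; filter-some)
open import Data.List.Relation.Unary.All as All using (All; _∷_)
open import Data.List.Relation.Unary.All.Properties using (replicate⁺; ¬Any⇒All¬; ++⁺; ++⁻ʳ)
open import Data.List.Relation.Unary.Any using (here; there)
open import Data.List.Relation.Unary.Linked using (Linked)
open import Data.List.Membership.Propositional using (_∈_; _∉_)
open import Data.List.Membership.Propositional.Properties using (∈-∃++; ∈-++⁻)
open import Data.List.Membership.DecPropositional _≟_ using (_∈?_)
open import Data.List.Relation.Binary.Permutation.Propositional using (_↭_; ↭-refl; ↭-sym; ↭-trans; prep; ↭⇒↭ₛ)
open import Data.List.Relation.Binary.Permutation.Propositional.Properties
  using (filter-↭; ↭-length; shift; ++-comm; drop-∷; ∈-resp-↭; All-resp-↭)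
open import Data.List.Relation.Binary.Pointwise using (Pointwise-≡⇒≡)
open import Data.List.Relation.Unary.Sorted.TotalOrder.Properties using (↗↭↗⇒≋)
import Data.List.Sort as Sort
import Relation.Binary.Construct.Flip.EqAndOrd as Flip
open import Data.Product using (∃-syntax; _×_; _,_; proj₁; proj₂; map₁)
open import Data.Sum using (_⊎_; inj₁; inj₂; [_,_]′)
open import Function using (_∘_; id)
open import Function.Bundles using (_⇔_; mk⇔)
open import Induction.WellFounded using (Acc; acc)
open import Relation.Nullary using (¬_; yes; no; contradiction)
open import Relation.Nullary.Decidable using (decidable-stable)
open import Relation.Unary using (Decidable)
open import Relation.Binary.PropositionalEquality hiding ([_])

open Sort (Flip.decTotalOrder ≤-decTotalOrder) using (sort; sort-↭; sort-↗)

mult-++ : ∀ v xs ys → mult v (xs ++ ys) ≡ mult v xs + mult v ys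
mult-++ v xs ys = trans (cong length (filter-++ (v ≟_) xs ys)) (length-++ (filter (v ≟_) xs))

mult-↭ : ∀ v {xs ys} → xs ↭ ys → mult v xs ≡ mult v ys
mult-↭ v xs↭ys = ↭-length (filter-↭ (v ≟_) xs↭ys)

mult-replicate : ∀ n v → mult v (replicate n v) ≡ n
mult-replicate n v = trans (cong length (filter-all (v ≟_) (replicate⁺ n refl))) (length-replicate n)

mult-replicate-≢ : ∀ n {v w} → v ≢ w → mult v (replicate n w) ≡ 0
mult-replicate-≢ n {v} v≢w = cong length (filter-none (v ≟_) (replicate⁺ n v≢w))

∈⇒mult>0 : ∀ {v xs} → v ∈ xs → 0 < mult v xs
∈⇒mult>0 {v} = filter-some (v ≟_)

∉⇒mult≡0 : ∀ {v xs} → v ∉ xs → mult v xs ≡ 0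
∉⇒mult≡0 {v} {xs} v∉xs = cong length (filter-none (v ≟_) (¬Any⇒All¬ xs v∉xs))

mult>0⇒∈ : ∀ {v xs} → 0 < mult v xs → v ∈ xs
mult>0⇒∈ {v} {xs} mult>0 with v ∈? xs
... | yes v∈xs = v∈xs
... | no v∉xs = contradiction (∉⇒mult≡0 v∉xs) (>⇒≢ mult>0)

mult<-from-∈ : ∀ {k v xs} → 0 < k → (v ∈ xs → mult v xs < k) → mult v xs < k
mult<-from-∈ {k} {v} {xs} k>0 bound with v ∈? xs
... | yes v∈xs = bound v∈xs
... | no v∉xs = subst (_< k) (sym (∉⇒mult≡0 v∉xs)) k>0

D⇒mult<k : ∀ {k n λs} → 0 < k → D k n λs → ∀ w → mult w λs < k
D⇒mult<k k>0 (_ , bounded) w = mult<-from-∈ k>0 (All.lookup bounded)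

∈-replicate⇒≡ : ∀ n {x y : ℕ} → x ∈ replicate n y → x ≡ y
∈-replicate⇒≡ n {y = y} = All.lookup {P = _≡ y} (replicate⁺ n refl)

∈⇒≤sum : ∀ {x xs} → x ∈ xs → x ≤ sum xs
∈⇒≤sum {xs = x ∷ xs} (here refl) = m≤m+n x (sum xs)
∈⇒≤sum {xs = x ∷ xs} (there x∈xs) = ≤-trans (∈⇒≤sum x∈xs) (m≤n+m (sum xs) x)

sum-replicate : ∀ n x → sum (replicate n x) ≡ n * x
sum-replicate zero x = refl
sum-replicate (suc n) x = cong (x +_) (sum-replicate n x)

_⊆ₘ_ : List ℕ → List ℕ → Set
ys ⊆ₘ xs = ∀ w → mult w ys ≤ mult w xs

∷-⊆ₘ-shift : ∀ y ys as bs → (y ∷ ys) ⊆ₘ (as ++ y ∷ bs) → ys ⊆ₘ (as ++ bs)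
∷-⊆ₘ-shift y ys as bs y∷ys⊆ w = +-cancelˡ-≤ (mult w [ y ]) _ _
  (subst₂ _≤_ (mult-++ w [ y ] ys)
              (trans (mult-↭ w (shift y as bs)) (mult-++ w [ y ] (as ++ bs)))
              (y∷ys⊆ w))

⊆ₘ⇒∃↭++ : ∀ ys {xs} → ys ⊆ₘ xs → ∃[ zs ] (xs ↭ ys ++ zs)
⊆ₘ⇒∃↭++ [] {xs} _ = xs , ↭-refl
⊆ₘ⇒∃↭++ (y ∷ ys) {xs} y∷ys⊆xs
  with ∈-∃++ {v = y} {xs} (mult>0⇒∈ (<-≤-trans (∈⇒mult>0 {y} {y ∷ ys} (here refl)) (y∷ys⊆xs y)))
... | as , bs , refl with ⊆ₘ⇒∃↭++ ys (∷-⊆ₘ-shift y ys as bs y∷ys⊆xs)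
...   | zs , as++bs↭ = zs , ↭-trans (shift y as bs) (prep y as++bs↭)

↭-++-cancelˡ : ∀ xs {ys zs : List ℕ} → xs ++ ys ↭ xs ++ zs → ys ↭ zs
↭-++-cancelˡ [] ys↭zs = ys↭zs
↭-++-cancelˡ (x ∷ xs) p = ↭-++-cancelˡ xs (drop-∷ p)

↭-++-cancelʳ : ∀ zs {xs ys : List ℕ} → xs ++ zs ↭ ys ++ zs → xs ↭ ys
↭-++-cancelʳ zs p = ↭-++-cancelˡ zs (↭-trans (++-comm zs _) (↭-trans p (++-comm _ zs)))

≥-sorted-↭⇒≡ : ∀ {xs ys} → Linked _≥_ xs → Linked _≥_ ys → xs ↭ ys → xs ≡ ys
≥-sorted-↭⇒≡ xs≥ ys≥ xs↭ys = Pointwise-≡⇒≡ (↗↭↗⇒≋ (Flip.totalOrder ≤-totalOrder) xs≥ ys≥ (↭⇒↭ₛ xs↭ys))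

module _ {p} {P : ℕ → Set p} (P? : Decidable P) where

  all-or-least-failure : ∀ a b → (∀ e → a < e → e < b → P e)
                                ⊎ ∃[ c ] (a < c × ¬ P c × (∀ e → a < e → e < c → P e))
  all-or-least-failure a zero = inj₁ λ _ _ ()
  all-or-least-failure a (suc b) with all-or-least-failure a b
  ... | inj₂ found = inj₂ found
  ... | inj₁ below with a <? b | P? b
  ...   | yes a<b | no ¬Pb = inj₂ (b , a<b , ¬Pb , below)
  ...   | yes _ | yes Pb = inj₁ λ e a<e e<1+b → [ below e a<e , (λ { refl → Pb }) ]′ (m<1+n⇒m<n∨m≡n e<1+b)
  ...   | no a≮b | _ = inj₁ λ e a<e e<1+b → contradiction (<-≤-trans a<e (s≤s⁻¹ e<1+b)) a≮b

  least-failure-above : ∀ {a b} → a < b → ¬ P b → ∃[ c ] (a < c × ¬ P c × (∀ e → a < e → e < c → P e))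
  least-failure-above {a} {b} a<b ¬Pb with all-or-least-failure a b
  ... | inj₁ below = b , a<b , ¬Pb , below
  ... | inj₂ found = found

-- k = 2 + k₀, so that k ∸ 1 computes to suc k₀.
module Base (k₀ : ℕ) where

  k : ℕ
  k = suc (suc k₀)

  k∣k^[1+a]*d : ∀ a d → k ∣ k ^ suc a * d
  k∣k^[1+a]*d a d = ∣m⇒∣m*n d (m∣m*n (k ^ a))

  k^*-unique : ∀ {a a′ d d′} → ¬ k ∣ d → ¬ k ∣ d′ → k ^ a * d ≡ k ^ a′ * d′ → a ≡ a′ × d ≡ d′
  k^*-unique {zero} {zero} {d} {d′} _ _ eq = refl , trans (sym (*-identityˡ d)) (trans eq (*-identityˡ d′))
  k^*-unique {zero} {suc a′} {d} k∤d _ eq =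
    contradiction (subst (k ∣_) (trans (sym eq) (*-identityˡ d)) (k∣k^[1+a]*d a′ _)) k∤d
  k^*-unique {suc a} {zero} {d′ = d′} _ k∤d′ eq =
    contradiction (subst (k ∣_) (trans eq (*-identityˡ d′)) (k∣k^[1+a]*d a _)) k∤d′
  k^*-unique {suc a} {suc a′} {d} {d′} k∤d k∤d′ eq = map₁ (cong suc) (k^*-unique k∤d k∤d′
    (*-cancelˡ-≡ _ _ k (trans (sym (*-assoc k (k ^ a) d)) (trans eq (*-assoc k (k ^ a′) d′)))))

  k^-injective : ∀ {d} → ¬ k ∣ d → ∀ {a a′} → k ^ a * d ≡ k ^ a′ * d → a ≡ a′
  k^-injective k∤d eq = proj₁ (k^*-unique k∤d k∤d eq)

  k∤d⇒d>0 : ∀ {d} → ¬ k ∣ d → 0 < d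
  k∤d⇒d>0 {zero} k∤0 = contradiction (k ∣0) k∤0
  k∤d⇒d>0 {suc d} _ = z<s

  k^*>0 : ∀ c {d} → ¬ k ∣ d → 0 < k ^ c * d
  k^*>0 c k∤d = *-mono-≤ (m^n>0 k c) (k∤d⇒d>0 k∤d)

  k-adic : ∀ v → 0 < v → ∃[ a ] ∃[ d ] (¬ k ∣ d × v ≡ k ^ a * d)
  k-adic v = go v (<-wellFounded v)
    where
    go : ∀ v → Acc _<_ v → 0 < v → ∃[ a ] ∃[ d ] (¬ k ∣ d × v ≡ k ^ a * d)
    go v _ _ with k ∣? v
    go v _ _ | no k∤v = 0 , v , k∤v , sym (*-identityˡ v)
    go v _ v>0 | yes (divides zero v≡0) = contradiction v≡0 (>⇒≢ v>0)
    go v (acc smaller) _ | yes (divides q@(suc _) v≡q*k)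
      with go q (smaller (subst (q <_) (sym v≡q*k) (m<m*n q k (s<s z<s)))) z<s
    ... | a , d , k∤d , q≡ = suc a , d , k∤d , (begin
      v                 ≡⟨ v≡q*k ⟩
      q * k             ≡⟨ cong (_* k) q≡ ⟩
      k ^ a * d * k     ≡⟨ *-comm (k ^ a * d) k ⟩
      k * (k ^ a * d)   ≡⟨ *-assoc k (k ^ a) d ⟨
      k ^ suc a * d     ∎)
      where open ≡-Reasoning

  n<k^n : ∀ n → n < k ^ n
  n<k^n zero = z<s
  n<k^n (suc n) = ≤-trans (+-mono-≤ (m^n>0 k n) (n<k^n n)) (+-monoʳ-≤ (k ^ n) (m≤m+n (k ^ n) (k₀ * k ^ n)))

  n<k^[a+1+n]*d : ∀ n a {d} → 0 < d → n < k ^ (a + suc n) * d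
  n<k^[a+1+n]*d n a d>0 = <-≤-trans (n<k^n n)
    (≤-trans (^-monoʳ-≤ k (≤-trans (n≤1+n n) (m≤n+m (suc n) a))) (m≤m*n _ _ {{>-nonZero d>0}}))

  ladder : ℕ → ℕ → ℕ → List ℕ
  ladder d a zero = []
  ladder d a (suc m) = replicate (k ∸ 1) (k ^ suc a * d) ++ ladder d (suc a) m

  concatMap-rungs≡ladder : ∀ d a₀ a m (f : ℕ → ℕ) → (∀ j → a₀ + suc (f j) ≡ suc (a + j)) →
    concatMap (λ j → replicate (k ∸ 1) (k ^ (a₀ + suc j) * d)) (applyUpTo f m) ≡ ladder d a m
  concatMap-rungs≡ladder d a₀ a zero f exponent = refl
  concatMap-rungs≡ladder d a₀ a (suc m) f exponent = cong₂ _++_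
    (cong (λ c → replicate (k ∸ 1) (k ^ c * d)) (trans (exponent 0) (cong suc (+-identityʳ a))))
    (concatMap-rungs≡ladder d a₀ (suc a) m (f ∘ suc) (λ j → trans (exponent (suc j)) (cong suc (+-suc a j))))

  added≡ : ∀ d a m → added k d a (suc (a + m)) ≡ replicate k (k ^ a * d) ++ ladder d a m
  added≡ d a m rewrite trans (cong (_∸ a) (sym (+-suc a m))) (m+n∸m≡n a (suc m)) =
    cong (replicate k (k ^ a * d) ++_) (concatMap-rungs≡ladder d a a m id (+-suc a))

  ∈-ladder⁻ : ∀ {w} d a m → w ∈ ladder d a m → ∃[ c ] (a < c × c ≤ a + m × w ≡ k ^ c * d)
  ∈-ladder⁻ d a (suc m) w∈ with ∈-++⁻ (replicate (k ∸ 1) (k ^ suc a * d)) w∈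
  ... | inj₁ w∈rung =
    suc a , ≤-refl , subst (suc a ≤_) (sym (+-suc a m)) (s≤s (m≤m+n a m)) , ∈-replicate⇒≡ (k ∸ 1) w∈rung
  ... | inj₂ w∈above with ∈-ladder⁻ d (suc a) m w∈above
  ...   | c , 1+a<c , c≤ , w≡ = c , <-trans (n<1+n a) 1+a<c , subst (c ≤_) (sym (+-suc a m)) c≤ , w≡

  ∉-ladder : ∀ {d} → ¬ k ∣ d → ∀ a m {c} → c ≤ a → k ^ c * d ∉ ladder d a m
  ∉-ladder k∤d a m c≤a x∈ with ∈-ladder⁻ _ a m x∈
  ... | c′ , a<c′ , _ , eq = <⇒≱ a<c′ (subst (_≤ _) (k^-injective k∤d eq) c≤a)

  mult-ladder : ∀ {d} → ¬ k ∣ d → ∀ a m {c} → a < c → c ≤ a + m → mult (k ^ c * d) (ladder d a m) ≡ k ∸ 1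
  mult-ladder k∤d a zero a<c c≤a+0 = contradiction (subst (_ ≤_) (+-identityʳ a) c≤a+0) (<⇒≱ a<c)
  mult-ladder {d} k∤d a (suc m) {c} a<c c≤ with c ≟ suc a
  ... | yes refl = begin
    mult x (replicate (k ∸ 1) x ++ ladder d (suc a) m)  ≡⟨ mult-++ x (replicate (k ∸ 1) x) _ ⟩
    mult x (replicate (k ∸ 1) x) + mult x (ladder d (suc a) m)
      ≡⟨ cong₂ _+_ (mult-replicate (k ∸ 1) x) (∉⇒mult≡0 (∉-ladder k∤d (suc a) m ≤-refl)) ⟩
    k ∸ 1 + 0                                          ≡⟨ +-identityʳ (k ∸ 1) ⟩
    k ∸ 1                                              ∎
    where
      open ≡-Reasoning
      x = k ^ suc a * d
  ... | no c≢1+a = trans (mult-++ (k ^ c * d) (replicate (k ∸ 1) (k ^ suc a * d)) _)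
    (cong₂ _+_ (mult-replicate-≢ (k ∸ 1) (c≢1+a ∘ k^-injective k∤d))
               (mult-ladder k∤d (suc a) m (≤∧≢⇒< a<c (c≢1+a ∘ sym)) (subst (c ≤_) (+-suc a m) c≤)))

  sum-ladder : ∀ d a m → k ^ suc a * d + sum (ladder d a m) ≡ k ^ suc (a + m) * d
  sum-ladder d a zero = trans (+-identityʳ _) (cong (λ e → k ^ suc e * d) (sym (+-identityʳ a)))
  sum-ladder d a (suc m) = begin
    x + sum (replicate (k ∸ 1) x ++ L)         ≡⟨ cong (x +_) (sum-++ (replicate (k ∸ 1) x) L) ⟩
    x + (sum (replicate (k ∸ 1) x) + sum L)    ≡⟨ cong (λ s → x + (s + sum L)) (sum-replicate (k ∸ 1) x) ⟩
    x + ((k ∸ 1) * x + sum L)                  ≡⟨ +-assoc x ((k ∸ 1) * x) (sum L) ⟨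
    k * x + sum L                              ≡⟨ cong (_+ sum L) (*-assoc k (k ^ suc a) d) ⟨
    k ^ suc (suc a) * d + sum L                ≡⟨ sum-ladder d (suc a) m ⟩
    k ^ suc (suc a + m) * d                    ≡⟨ cong (λ e → k ^ suc e * d) (+-suc a m) ⟨
    k ^ suc (a + suc m) * d                    ∎
    where
      open ≡-Reasoning
      x = k ^ suc a * d
      L = ladder d (suc a) m

  ∈-added⁻ : ∀ {d a b w} → a < b → w ∈ added k d a b → ∃[ c ] (a ≤ c × c < b × w ≡ k ^ c * d)
  ∈-added⁻ {d} {a} {w = w} a<b w∈ with m≤n⇒∃[o]m+o≡n a<b
  ... | m , refl with ∈-++⁻ (replicate k (k ^ a * d)) (subst (w ∈_) (added≡ d a m) w∈)
  ...   | inj₁ w∈base = a , ≤-refl , a<b , ∈-replicate⇒≡ k w∈base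
  ...   | inj₂ w∈ladder with ∈-ladder⁻ d a m w∈ladder
  ...     | c , a<c , c≤a+m , w≡ = c , <⇒≤ a<c , s≤s c≤a+m , w≡

  mult-added-base : ∀ {d a b} → ¬ k ∣ d → a < b → mult (k ^ a * d) (added k d a b) ≡ k
  mult-added-base {d} {a} k∤d a<b with m≤n⇒∃[o]m+o≡n a<b
  ... | m , refl = begin
    mult v (added k d a (suc (a + m)))                  ≡⟨ cong (mult v) (added≡ d a m) ⟩
    mult v (replicate k v ++ ladder d a m)              ≡⟨ mult-++ v (replicate k v) _ ⟩
    mult v (replicate k v) + mult v (ladder d a m)
      ≡⟨ cong₂ _+_ (mult-replicate k v) (∉⇒mult≡0 (∉-ladder k∤d a m ≤-refl)) ⟩
    k + 0                                                ≡⟨ +-identityʳ k ⟩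
    k                                                    ∎
    where
      open ≡-Reasoning
      v = k ^ a * d

  mult-added-rung : ∀ {d a b c} → ¬ k ∣ d → a < c → c < b → mult (k ^ c * d) (added k d a b) ≡ k ∸ 1
  mult-added-rung {d} {a} {c = c} k∤d a<c c<b with m≤n⇒∃[o]m+o≡n (<-trans a<c c<b)
  ... | m , refl = begin
    mult w (added k d a (suc (a + m)))                   ≡⟨ cong (mult w) (added≡ d a m) ⟩
    mult w (replicate k (k ^ a * d) ++ ladder d a m)     ≡⟨ mult-++ w (replicate k (k ^ a * d)) _ ⟩
    mult w (replicate k (k ^ a * d)) + mult w (ladder d a m)
      ≡⟨ cong₂ _+_ (mult-replicate-≢ k (<⇒≢ a<c ∘ sym ∘ k^-injective k∤d))
                   (mult-ladder k∤d a m a<c (s≤s⁻¹ c<b)) ⟩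
    k ∸ 1                                                ∎
    where
      open ≡-Reasoning
      w = k ^ c * d

  sum-added : ∀ {d a b} → a < b → sum (added k d a b) ≡ k ^ b * d
  sum-added {d} {a} a<b with m≤n⇒∃[o]m+o≡n a<b
  ... | m , refl = begin
    sum (added k d a (suc (a + m)))                      ≡⟨ cong sum (added≡ d a m) ⟩
    sum (replicate k (k ^ a * d) ++ ladder d a m)        ≡⟨ sum-++ (replicate k (k ^ a * d)) _ ⟩
    sum (replicate k (k ^ a * d)) + sum (ladder d a m)   ≡⟨ cong (_+ sum (ladder d a m)) (sum-replicate k (k ^ a * d)) ⟩
    k * (k ^ a * d) + sum (ladder d a m)                 ≡⟨ cong (_+ sum (ladder d a m)) (*-assoc k (k ^ a) d) ⟨
    k ^ suc a * d + sum (ladder d a m)                   ≡⟨ sum-ladder d a m ⟩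
    k ^ suc (a + m) * d                                  ∎
    where open ≡-Reasoning

  added-positive : ∀ {d a b} → ¬ k ∣ d → a < b → All (0 <_) (added k d a b)
  added-positive k∤d a<b = All.tabulate λ w∈ →
    let (c , _ , _ , w≡) = ∈-added⁻ a<b w∈ in subst (0 <_) (sym w≡) (k^*>0 c k∤d)

  top∉added : ∀ {d a b} → ¬ k ∣ d → a < b → k ^ b * d ∉ added k d a b
  top∉added k∤d a<b x∈ = let (c , _ , c<b , x≡) = ∈-added⁻ a<b x∈ in <⇒≢ c<b (sym (k^-injective k∤d x≡))

  data Place (d a b w : ℕ) : Set where
    base  : w ≡ k ^ a * d → Place d a b w
    rung  : ∀ {c} → a < c → c < b → w ≡ k ^ c * d → Place d a b w
    top   : w ≡ k ^ b * d → Place d a b w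
    other : w ∉ added k d a b → w ≢ k ^ b * d → Place d a b w

  place : ∀ {d a b} → a < b → ∀ w → Place d a b w
  place {d} {a} {b} a<b w with w ∈? added k d a b
  ... | yes w∈ with ∈-added⁻ a<b w∈
  ...   | c , a≤c , c<b , w≡ with m≤n⇒m<n∨m≡n a≤c
  ...     | inj₁ a<c = rung a<c c<b w≡
  ...     | inj₂ refl = base w≡
  place {d} {a} {b} a<b w | no w∉ with w ≟ k ^ b * d
  ... | yes w≡ = top w≡
  ... | no w≢ = other w∉ w≢

  module TauStep {d a b : ℕ} {λs μ rest : List ℕ} (k∤d : ¬ k ∣ d) (a<b : a < b)
                 (λ↭ : λs ↭ k ^ b * d ∷ rest) (μ↭ : μ ↭ rest ++ added k d a b) where

    private
      mult-λs-off : ∀ {w} → w ≢ k ^ b * d → mult w λs ≡ mult w rest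
      mult-λs-off {w} w≢x =
        trans (mult-↭ w λ↭) (trans (mult-++ w [ k ^ b * d ] rest) (cong (_+ mult w rest) (mult-replicate-≢ 1 w≢x)))

      mult-μ : ∀ w → mult w μ ≡ mult w rest + mult w (added k d a b)
      mult-μ w = trans (mult-↭ w μ↭) (mult-++ w rest _)

      mult-μ-off : ∀ {w} → w ∉ added k d a b → mult w μ ≡ mult w rest
      mult-μ-off {w} w∉ = trans (mult-μ w) (trans (cong (mult w rest +_) (∉⇒mult≡0 w∉)) (+-identityʳ _))

    base-mult : mult (k ^ a * d) μ ≡ mult (k ^ a * d) λs + k
    base-mult = trans (mult-μ _)
      (cong₂ _+_ (sym (mult-λs-off (<⇒≢ a<b ∘ k^-injective k∤d))) (mult-added-base k∤d a<b))

    rung-mult : ∀ {c} → a < c → c < b → mult (k ^ c * d) μ ≡ mult (k ^ c * d) λs + (k ∸ 1)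
    rung-mult a<c c<b = trans (mult-μ _)
      (cong₂ _+_ (sym (mult-λs-off (<⇒≢ c<b ∘ k^-injective k∤d))) (mult-added-rung k∤d a<c c<b))

    top-mult : suc (mult (k ^ b * d) μ) ≡ mult (k ^ b * d) λs
    top-mult = begin
      suc (mult x μ)              ≡⟨ cong suc (mult-μ-off (top∉added k∤d a<b)) ⟩
      suc (mult x rest)           ≡⟨ cong (_+ mult x rest) (mult-replicate 1 x) ⟨
      mult x [ x ] + mult x rest  ≡⟨ mult-++ x [ x ] rest ⟨
      mult x (x ∷ rest)           ≡⟨ mult-↭ x λ↭ ⟨
      mult x λs                   ∎
      where
        open ≡-Reasoning
        x = k ^ b * d

    other-mult : ∀ {w} → w ∉ added k d a b → w ≢ k ^ b * d → mult w μ ≡ mult w λs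
    other-mult w∉ w≢x = trans (mult-μ-off w∉) (sym (mult-λs-off w≢x))

  record Move (d a b : ℕ) (λs μ : List ℕ) : Set where
    field
      k∤d         : ¬ k ∣ d
      mult<k      : ∀ w → mult w λs < k
      consecutive : Consecutive k d λs a b
      rest        : List ℕ
      λ↭          : λs ↭ k ^ b * d ∷ rest
      μ↭          : μ ↭ rest ++ added k d a b

    a<b : a < b
    a<b = proj₁ consecutive

    open TauStep k∤d a<b λ↭ μ↭ public

    base-mult>k : k < mult (k ^ a * d) μ
    base-mult>k = subst (k <_) (sym base-mult) (+-monoˡ-< k (∈⇒mult>0 (proj₁ (proj₂ consecutive))))

    base-mult<2k : mult (k ^ a * d) μ < 2 * k
    base-mult<2k = subst₂ _<_ (sym base-mult) (cong (k +_) (sym (+-identityʳ k))) (+-monoˡ-< k (mult<k _))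

    rung-mult≡ : ∀ {c} → a < c → c < b → mult (k ^ c * d) μ ≡ k ∸ 1
    rung-mult≡ {c} a<c c<b =
      trans (rung-mult a<c c<b) (cong (_+ (k ∸ 1)) (∉⇒mult≡0 (proj₂ (proj₂ (proj₂ consecutive)) c a<c c<b)))

    top-mult<k∸1 : mult (k ^ b * d) μ < k ∸ 1
    top-mult<k∸1 = s≤s⁻¹ (subst (_< k) (sym top-mult) (mult<k _))

    others<k : ∀ w → w ≢ k ^ a * d → mult w μ < k
    others<k w w≢v with place {d} a<b w
    ... | base w≡v = contradiction w≡v w≢v
    ... | rung a<c c<b refl = subst (_< k) (sym (rung-mult≡ a<c c<b)) ≤-refl
    ... | top refl = <-trans top-mult<k∸1 ≤-refl
    ... | other w∉ w≢x = subst (_< k) (sym (other-mult w∉ w≢x)) (mult<k w)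

  InTau⇒Move : ∀ {n d λs μ} → D k n λs → ¬ k ∣ d → InTau k d λs μ → ∃[ a ] ∃[ b ] Move d a b λs μ
  InTau⇒Move Dλ k∤d (_ , a , b , consecutive , rest , λ↭ , μ↭) = a , b , record
    { k∤d = k∤d ; mult<k = D⇒mult<k z<s Dλ ; consecutive = consecutive ; rest = rest ; λ↭ = λ↭ ; μ↭ = μ↭ }

  Move⇒InTau : ∀ {d a b λs μ} → Linked _≥_ μ → Move d a b λs μ → InTau k d λs μ
  Move⇒InTau {a = a} {b} μ≥ m = μ≥ , a , b , consecutive , rest , λ↭ , μ↭
    where open Move m

  Move⇒T : ∀ {n d a b λs μ} → D k n λs → Linked _≥_ μ → Move d a b λs μ → T k n μ
  Move⇒T {n} {d} {a} {b} {λs} {μ} ((_ , λs>0 , sum-λs) , _) μ≥ m =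
    (μ≥ , μ>0 , sum-μ) , k ^ a * d , base-mult>k , base-mult<2k , λ w _ → others<k w
    where
      open Move m
      μ>0 : All (0 <_) μ
      μ>0 = All-resp-↭ (↭-sym μ↭) (++⁺ (All.tail (All-resp-↭ λ↭ λs>0)) (added-positive k∤d a<b))
      sum-μ : sum μ ≡ n
      sum-μ = begin
        sum μ                              ≡⟨ sum-↭ μ↭ ⟩
        sum (rest ++ added k d a b)        ≡⟨ sum-++ rest _ ⟩
        sum rest + sum (added k d a b)     ≡⟨ cong (sum rest +_) (sum-added a<b) ⟩
        sum rest + k ^ b * d               ≡⟨ +-comm (sum rest) _ ⟩
        sum (k ^ b * d ∷ rest)             ≡⟨ sum-↭ λ↭ ⟨
        sum λs                             ≡⟨ sum-λs ⟩
        n                                  ∎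
        where open ≡-Reasoning

  -- Undoing τ: b is the least exponent above a at which μ does not have k − 1 copies of k^b d.
  module InverseMove {n d a b : ℕ} {μ : List ℕ} (μ-part : IsPartition n μ) (k∤d : ¬ k ∣ d)
      (base-mult>k : k < mult (k ^ a * d) μ) (base-mult<2k : mult (k ^ a * d) μ < 2 * k)
      (others<k : ∀ w → w ≢ k ^ a * d → mult w μ < k)
      (a<b : a < b) (top≢ : mult (k ^ b * d) μ ≢ k ∸ 1)
      (rungs : ∀ c → a < c → c < b → mult (k ^ c * d) μ ≡ k ∸ 1) where

    added⊆μ : added k d a b ⊆ₘ μ
    added⊆μ w with place {d} a<b w
    ... | base refl = subst (_≤ _) (sym (mult-added-base k∤d a<b)) (<⇒≤ base-mult>k)
    ... | rung a<c c<b refl = ≤-reflexive (trans (mult-added-rung k∤d a<c c<b) (sym (rungs _ a<c c<b)))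
    ... | top refl = subst (_≤ _) (sym (∉⇒mult≡0 (top∉added k∤d a<b))) z≤n
    ... | other w∉ _ = subst (_≤ _) (sym (∉⇒mult≡0 w∉)) z≤n

    rest : List ℕ
    rest = proj₁ (⊆ₘ⇒∃↭++ (added k d a b) {μ} added⊆μ)

    μ↭added++rest : μ ↭ added k d a b ++ rest
    μ↭added++rest = proj₂ (⊆ₘ⇒∃↭++ (added k d a b) {μ} added⊆μ)

    λs : List ℕ
    λs = sort (k ^ b * d ∷ rest)

    λ↭ : λs ↭ k ^ b * d ∷ rest
    λ↭ = sort-↭ _

    open TauStep k∤d a<b λ↭ (↭-trans μ↭added++rest (++-comm (added k d a b) rest))

    base-mult>0 : 0 < mult (k ^ a * d) λs
    base-mult>0 = +-cancelʳ-< k 0 _ (subst (k <_) base-mult base-mult>k)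

    rung-mult≡0 : ∀ {c} → a < c → c < b → mult (k ^ c * d) λs ≡ 0
    rung-mult≡0 a<c c<b = +-cancelʳ-≡ (k ∸ 1) _ 0 (trans (sym (rung-mult a<c c<b)) (rungs _ a<c c<b))

    mult<k : ∀ w → mult w λs < k
    mult<k w with place {d} a<b w
    ... | base refl = +-cancelʳ-< k _ k (subst₂ _<_ base-mult (cong (k +_) (+-identityʳ k)) base-mult<2k)
    ... | rung a<c c<b refl = subst (_< k) (sym (rung-mult≡0 a<c c<b)) z<s
    ... | top refl = subst (_< k) top-mult
      (s≤s (≤∧≢⇒< (s≤s⁻¹ (others<k _ (<⇒≢ a<b ∘ sym ∘ k^-injective k∤d))) top≢))
    ... | other w∉ w≢x = subst (_< k) (other-mult w∉ w≢x) (others<k w λ { refl → w∉ base∈added })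
      where
        base∈added : k ^ a * d ∈ added k d a b
        base∈added = mult>0⇒∈ (subst (0 <_) (sym (mult-added-base k∤d a<b)) z<s)

    D-λs : D k n λs
    D-λs = (sort-↗ _ , λs>0 , sum-λs) , All.tabulate λ {w} _ → mult<k w
      where
        open ≡-Reasoning
        λs>0 : All (0 <_) λs
        λs>0 = All-resp-↭ (↭-sym λ↭)
          (k^*>0 b k∤d ∷ ++⁻ʳ (added k d a b) (All-resp-↭ μ↭added++rest (proj₁ (proj₂ μ-part))))
        sum-λs : sum λs ≡ n
        sum-λs = begin
          sum λs                             ≡⟨ sum-↭ λ↭ ⟩
          k ^ b * d + sum rest               ≡⟨ cong (_+ sum rest) (sum-added a<b) ⟨
          sum (added k d a b) + sum rest     ≡⟨ sum-++ (added k d a b) rest ⟨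
          sum (added k d a b ++ rest)        ≡⟨ sum-↭ μ↭added++rest ⟨
          sum μ                              ≡⟨ proj₂ (proj₂ μ-part) ⟩
          n                                  ∎

    move : Move d a b λs μ
    move = record
      { k∤d = k∤d
      ; mult<k = mult<k
      ; consecutive = a<b , mult>0⇒∈ base-mult>0 , ∈-resp-↭ (↭-sym λ↭) (here refl)
                      , λ c a<c c<b c∈ → <⇒≢ (∈⇒mult>0 c∈) (sym (rung-mult≡0 a<c c<b))
      ; rest = rest
      ; λ↭ = λ↭
      ; μ↭ = ↭-trans μ↭added++rest (++-comm (added k d a b) rest)
      }

  T⇒Move : ∀ {n μ} → T k n μ → ∃[ d ] ∃[ a ] ∃[ b ] ∃[ λs ] (D k n λs × Move d a b λs μ)
  T⇒Move {n} {μ} (μ-part@(_ , μ>0 , sum-μ) , v , k<mv , mv<2k , others)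
    with k-adic v (All.lookup μ>0 (mult>0⇒∈ (<-trans z<s k<mv)))
  ... | a , d , k∤d , refl
    with least-failure-above (λ c → mult (k ^ c * d) μ ≟ k ∸ 1) (m<m+n a z<s) escapes
    where
      -- k^(a+1+n) d exceeds n, so it is not a part of μ.
      escapes : mult (k ^ (a + suc n) * d) μ ≢ k ∸ 1
      escapes = subst (_≢ k ∸ 1) (sym (∉⇒mult≡0 {xs = μ} λ x∈ →
        <⇒≱ (n<k^[a+1+n]*d n a (k∤d⇒d>0 k∤d)) (subst (_ ≤_) sum-μ (∈⇒≤sum x∈)))) λ ()
  ... | b , a<b , top≢ , rungs = d , a , b , λs , D-λs , move
    where
      others<k : ∀ w → w ≢ k ^ a * d → mult w μ < k
      others<k w w≢v = mult<-from-∈ z<s λ w∈ → others w w∈ w≢v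
      open InverseMove μ-part k∤d k<mv mv<2k others<k a<b top≢ rungs

  -- k^a d is the only value occurring at least k times in τ(λ).
  Move-base-unique : ∀ {d₁ d₂ a₁ a₂ b₁ b₂ λ₁ λ₂ μ} →
                     Move d₁ a₁ b₁ λ₁ μ → Move d₂ a₂ b₂ λ₂ μ → a₁ ≡ a₂ × d₁ ≡ d₂
  Move-base-unique m₁ m₂ = k^*-unique (Move.k∤d m₁) (Move.k∤d m₂) (decidable-stable (_ ≟ _)
    λ v₁≢v₂ → <-asym (Move.base-mult>k m₁) (Move.others<k m₂ _ v₁≢v₂))

  -- k^b₁ d would be a rung of the second move (k − 1 copies) but is the top of the first (fewer).
  Move-top-≮ : ∀ {d a b₁ b₂ λ₁ λ₂ μ} → Move d a b₁ λ₁ μ → Move d a b₂ λ₂ μ → ¬ b₁ < b₂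
  Move-top-≮ m₁ m₂ b₁<b₂ = <-irrefl (Move.rung-mult≡ m₂ (Move.a<b m₁) b₁<b₂) (Move.top-mult<k∸1 m₁)

  Move-source-unique : ∀ {d a b λ₁ λ₂ μ} → Linked _≥_ λ₁ → Linked _≥_ λ₂ →
                       Move d a b λ₁ μ → Move d a b λ₂ μ → λ₁ ≡ λ₂
  Move-source-unique {d} {a} {b} λ₁≥ λ₂≥ m₁ m₂ =
    ≥-sorted-↭⇒≡ λ₁≥ λ₂≥ (↭-trans (Move.λ↭ m₁) (↭-trans (prep _ rest₁↭rest₂) (↭-sym (Move.λ↭ m₂))))
    where
      rest₁↭rest₂ : Move.rest m₁ ↭ Move.rest m₂
      rest₁↭rest₂ = ↭-++-cancelʳ (added k d a b) (↭-trans (↭-sym (Move.μ↭ m₁)) (Move.μ↭ m₂))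

  Move-disjoint : ∀ {d₁ d₂ a₁ a₂ b₁ b₂ λ₁ λ₂ μ} → Linked _≥_ λ₁ → Linked _≥_ λ₂ →
                  Move d₁ a₁ b₁ λ₁ μ → Move d₂ a₂ b₂ λ₂ μ → λ₁ ≡ λ₂ × d₁ ≡ d₂
  Move-disjoint λ₁≥ λ₂≥ m₁ m₂ with Move-base-unique m₁ m₂
  ... | refl , refl with ≤-antisym (≮⇒≥ (Move-top-≮ m₂ m₁)) (≮⇒≥ (Move-top-≮ m₁ m₂))
  ... | refl = Move-source-unique λ₁≥ λ₂≥ m₁ m₂ , refl

theorem4p2 : (k n : ℕ) → 1 ≤ k →
    (∀ (μ : List ℕ) → T k n μ ⇔
        (∃[ λs ] (D k n λs × ∃[ d ] (1 ≤ d × ¬ (k ∣ d) × FMeets k d λs × InTau k d λs μ))))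
    ×
    (∀ (λ₁ λ₂ : List ℕ) (d₁ d₂ : ℕ) (μ : List ℕ) →
        D k n λ₁ → 1 ≤ d₁ → ¬ (k ∣ d₁) → FMeets k d₁ λ₁ →
        D k n λ₂ → 1 ≤ d₂ → ¬ (k ∣ d₂) → FMeets k d₂ λ₂ →
        InTau k d₁ λ₁ μ → InTau k d₂ λ₂ μ → λ₁ ≡ λ₂ × d₁ ≡ d₂)
theorem4p2 zero n ()
-- For k = 1 both sides are empty: no multiplicity lies strictly between 1 and 2, and 1 divides every d.
theorem4p2 (suc zero) n _ =
  (λ _ → mk⇔ (λ (_ , _ , 1<m , m<2 , _) → contradiction 1<m (<⇒≱ m<2))
             (λ (_ , _ , d , _ , 1∤d , _) → contradiction (1∣ d) 1∤d)) ,
  λ _ _ d₁ _ _ _ _ 1∤d₁ _ _ _ _ _ _ _ → contradiction (1∣ d₁) 1∤d₁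
theorem4p2 (suc (suc k₀)) n _ =
  (λ _ → mk⇔ forward backward) ,
  λ _ _ _ _ _ D₁ _ k∤d₁ _ D₂ _ k∤d₂ _ τ₁ τ₂ → Move-disjoint (proj₁ (proj₁ D₁)) (proj₁ (proj₁ D₂))
    (proj₂ (proj₂ (InTau⇒Move D₁ k∤d₁ τ₁))) (proj₂ (proj₂ (InTau⇒Move D₂ k∤d₂ τ₂)))
  where
    open Base k₀
    Source : List ℕ → Set
    Source μ = ∃[ λs ] (D k n λs × ∃[ d ] (1 ≤ d × ¬ (k ∣ d) × FMeets k d λs × InTau k d λs μ))
    forward : ∀ {μ} → T k n μ → Source μ
    forward tμ with T⇒Move tμ
    ... | d , a , b , λs , Dλ , m =
      λs , Dλ , d , k∤d⇒d>0 k∤d , k∤d , (a , proj₁ (proj₂ consecutive)) , Move⇒InTau (proj₁ (proj₁ tμ)) m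
      where open Move m
    backward : ∀ {μ} → Source μ → T k n μ
    backward (λs , Dλ , d , _ , k∤d , _ , τ) = Move⇒T Dλ (proj₁ τ) (proj₂ (proj₂ (InTau⇒Move Dλ k∤d τ)))
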